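{- Let the set of voters be $V=\mathbb{N}$, let $X$ be a set of alternatives, and let $x,y\in X$ be distinct. Let $S_{\{x,y\}}$ be the set of all natural numbers $e$ such that $e$ is a code, restricted to $\{x,y\}$, of some REC-measurable profile $f\in F_{\mathrm{REC}}$. Then $S_{\{x,y\}}$ is not recursively enumerable.
   Context: A weak order on $X$ is a binary relation $P$ on $X$ that is asymmetric ($xPy\implies\neg yPx$) and negatively transitive ($(\neg xPy\land\neg yPz)\implies\neg xPz$); $W$ is the set of weak orders on $X$ and a profile is a function $f:V\to W$. $\mathrm{REC}$ is the collection of computable subsets of $\mathbb{N}$; a profile $f$ is REC-measurable if $\{v: a\,f(v)\,b\}\in\mathrm{REC}$ for all $a,b\in X$, and $F_{\mathrm{REC}}$ is the set of such profiles. Fix a standard Gödel numbering $\varphi_e$ of partial recursive functions; $e$ is an index of $A\subseteq\mathbb{N}$ if $\varphi_e=\chi_A$. Pairs are coded by $\langle a,b\rangle=(a+b)^2+a$ and triples by $\langle a,b,c\rangle=\langle\langle a,b\rangle,c\rangle$. A code of $f$ restricted to $\{x,y\}$ is a number $e=\langle e_1,e_2,e_3\rangle$ where $e_1$ is an index of $\{v: x\,f(v)\,y\}$, $e_2$ is an index of $\{v: y\,f(v)\,x\}$, and $e_3$ is an index of $\{v: \neg(x\,f(v)\,y\lor y\,f(v)\,x)\}$. A set $B\subseteq\mathbb{N}$ is recursively enumerable if it is the domain of some $\varphi_e$. -}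

module Defs where

open import Data.Nat using (ℕ; zero; suc; _+_; _*_; _<_)
open import Data.Fin using (Fin; toℕ)
open import Data.Vec using (Vec; []; _∷_; [_])
open import Data.Product using (Σ; ∃; _×_; _,_)
open import Data.Sum using (_⊎_)
import Data.Vec
open import Relation.Nullary using (¬_)
open import Relation.Binary.PropositionalEquality using (_≡_)

pair : ℕ → ℕ → ℕ
pair a b = (a + b) * (a + b) + a

triple : ℕ → ℕ → ℕ → ℕ
triple a b c = pair (pair a b) c

data PR : ℕ → Set where
  zeroF : ∀ {n} → PR n
  succF : PR 1
  proj  : ∀ {n} → Fin n → PR n
  comp  : ∀ {m n} → PR m → Vec (PR n) m → PR n
  prec  : ∀ {n} → PR n → PR (suc (suc n)) → PR (suc n)
  mu    : ∀ {n} → PR (suc n) → PR n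

-- Big-step semantics: Eval f xs r  means  f(xs) is defined and equals r.
mutual
  data Eval : ∀ {n} → PR n → Vec ℕ n → ℕ → Set where
    ev-zero : ∀ {n} {xs : Vec ℕ n} → Eval zeroF xs 0
    ev-succ : ∀ {x} → Eval succF [ x ] (suc x)
    ev-proj : ∀ {n} {i : Fin n} {xs : Vec ℕ n} →
              Eval (proj i) xs (Data.Vec.lookup xs i)
    ev-comp : ∀ {m n} {g : PR m} {hs : Vec (PR n) m} {xs : Vec ℕ n}
                {ys : Vec ℕ m} {r : ℕ} →
              EvalVec hs xs ys → Eval g ys r → Eval (comp g hs) xs r
    ev-prec-z : ∀ {n} {g : PR n} {h : PR (suc (suc n))} {xs : Vec ℕ n} {r : ℕ} →
              Eval g xs r → Eval (prec g h) (zero ∷ xs) r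
    ev-prec-s : ∀ {n} {g : PR n} {h : PR (suc (suc n))} {xs : Vec ℕ n}
                  {k r' r : ℕ} →
              Eval (prec g h) (k ∷ xs) r' → Eval h (k ∷ r' ∷ xs) r →
              Eval (prec g h) (suc k ∷ xs) r
    ev-mu   : ∀ {n} {f : PR (suc n)} {xs : Vec ℕ n} {r : ℕ} →
              MuFrom f xs 0 r → Eval (mu f) xs r

  data EvalVec : ∀ {m n} → Vec (PR n) m → Vec ℕ n → Vec ℕ m → Set where
    evv-[] : ∀ {n} {xs : Vec ℕ n} → EvalVec [] xs []
    evv-∷  : ∀ {m n} {h : PR n} {hs : Vec (PR n) m} {xs : Vec ℕ n}
               {y : ℕ} {ys : Vec ℕ m} →
             Eval h xs y → EvalVec hs xs ys → EvalVec (h ∷ hs) xs (y ∷ ys)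

  data MuFrom : ∀ {n} → PR (suc n) → Vec ℕ n → ℕ → ℕ → Set where
    mu-here : ∀ {n} {f : PR (suc n)} {xs : Vec ℕ n} {k : ℕ} →
              Eval f (k ∷ xs) 0 → MuFrom f xs k k
    mu-next : ∀ {n} {f : PR (suc n)} {xs : Vec ℕ n} {k m r : ℕ} →
              Eval f (k ∷ xs) (suc m) → MuFrom f xs (suc k) r → MuFrom f xs k r

mutual
  code : ∀ {n} → PR n → ℕ
  code {n} zeroF        = pair 0 n
  code succF            = pair 1 0
  code {n} (proj i)     = pair 2 (pair n (toℕ i))
  code {n} (comp {m} g hs) = pair 3 (pair (pair m n) (pair (code g) (codeVec hs)))
  code {suc n} (prec g h) = pair 4 (pair n (pair (code g) (code h)))
  code {n} (mu f)       = pair 5 (pair n (code f))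

  codeVec : ∀ {m n} → Vec (PR n) m → ℕ
  codeVec []       = 0
  codeVec (h ∷ hs) = suc (pair (code h) (codeVec hs))

-- φ_e is the unary partial function computed by the program with number e
-- (and the everywhere-undefined function if e codes no unary program).
-- "φ_e(v) = r":
Φ : ℕ → ℕ → ℕ → Set
Φ e v r = Σ (PR 1) λ p → (code p ≡ e) × Eval p [ v ] r

Subset : Set₁
Subset = ℕ → Set

IsIndexOf : ℕ → Subset → Set
IsIndexOf e A = ∀ v → (A v → Φ e v 1) × (¬ A v → Φ e v 0)

REC : Subset → Set
REC A = ∃ λ e → IsIndexOf e A

RecEnum : ∀ {ℓ} → (ℕ → Set ℓ) → Set ℓ
RecEnum B = ∃ λ e → ∀ v → (B v → ∃ λ r → Φ e v r) × ((∃ λ r → Φ e v r) → B v)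

module _ (X : Set) where

  Relation : Set₁
  Relation = X → X → Set

  IsWeakOrder : Relation → Set
  IsWeakOrder P =
    (∀ a b → P a b → ¬ P b a) ×
    (∀ a b c → ¬ P a b → ¬ P b c → ¬ P a c)

  Profile : Set₁
  Profile = ℕ → Relation

  IsProfile : Profile → Set
  IsProfile f = ∀ v → IsWeakOrder (f v)

  RECMeasurable : Profile → Set
  RECMeasurable f = ∀ a b → REC (λ v → f v a b)

  IsCodeRestr : Profile → X → X → ℕ → Set
  IsCodeRestr f x y e =
    Σ ℕ λ e₁ → Σ ℕ λ e₂ → Σ ℕ λ e₃ →
      (e ≡ triple e₁ e₂ e₃) ×
      IsIndexOf e₁ (λ v → f v x y) ×
      IsIndexOf e₂ (λ v → f v y x) ×
      IsIndexOf e₃ (λ v → ¬ (f v x y ⊎ f v y x))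

  S : X → X → ℕ → Set₁
  S x y e = Σ Profile λ f → IsProfile f × RECMeasurable f × IsCodeRestr f x y e

-- Suppose S were the domain of φ_e. S is nonempty, so e is the code of a unary program p.
-- Running p for t steps is itself computable (every program compiles to a clocked version),
-- so by Kleene's recursion theorem there is a program T that on input t returns 0 while p,
-- run for t steps on w = ⟨code T, index of ∅, index of ℕ⟩, has not halted, and diverges
-- once it has. If p halts on w, then w ∈ S, so code T is an index and T is total, yet T
-- diverges from the halting time on. Hence p never halts on w; but then T is constantly 0,
-- an index of ∅, and w codes the empty profile, so w ∈ S and p halts on w after all.

module Submission where

open import Defs
open import Data.Nat
open import Data.Nat.Properties
open import Data.Product using (Σ; ∃; _×_; _,_; proj₁; proj₂)
open import Data.Sum using (inj₁; inj₂)
open import Data.Fin using (Fin; toℕ; _↑ʳ_) renaming (zero to fzero; suc to fsuc)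
open import Data.Fin.Properties using (toℕ-injective)
open import Data.Vec using (Vec; []; _∷_; [_]; _++_; lookup; map)
open import Data.Vec.Properties using (lookup-++ʳ)
open import Data.Empty using (⊥; ⊥-elim)
open import Function using (_∘_; _⇔_; mk⇔; Equivalence)
open import Function.Construct.Composition using (_⇔-∘_)
open import Relation.Binary.Definitions using (tri<; tri≈; tri>)
open import Relation.Binary.PropositionalEquality hiding ([_])
open import Relation.Nullary using (¬_)

-- Injectivity of codes and determinism of evaluation

n<m⇒n*n+n<m*m : ∀ {n m} → n < m → n * n + n < m * m
n<m⇒n*n+n<m*m {n} {m} n<m = begin-strict
  n * n + n      ≡⟨ +-comm (n * n) n ⟩
  n + n * n      ≡⟨ *-suc n n ⟨
  n * suc n      <⟨ s≤s (m≤n+m (n * suc n) n) ⟩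
  suc n * suc n  ≤⟨ *-mono-≤ n<m n<m ⟩
  m * m          ∎
  where open ≤-Reasoning

sum<⇒pair< : ∀ a b c d → a + b < c + d → pair a b < pair c d
sum<⇒pair< a b c d lt = begin-strict
  (a + b) * (a + b) + a        ≤⟨ +-monoʳ-≤ ((a + b) * (a + b)) (m≤m+n a b) ⟩
  (a + b) * (a + b) + (a + b)  <⟨ n<m⇒n*n+n<m*m lt ⟩
  (c + d) * (c + d)            ≤⟨ m≤m+n _ c ⟩
  (c + d) * (c + d) + c        ∎
  where open ≤-Reasoning

pair-injective : ∀ a b c d → pair a b ≡ pair c d → a ≡ c × b ≡ d
pair-injective a b c d eq with <-cmp (a + b) (c + d)
... | tri< lt _ _ = ⊥-elim (<⇒≢ (sum<⇒pair< a b c d lt) eq)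
... | tri> _ _ gt = ⊥-elim (<⇒≢ (sum<⇒pair< c d a b gt) (sym eq))
... | tri≈ _ sum≡ _ = a≡c , +-cancelˡ-≡ c b d (trans (cong (_+ b) (sym a≡c)) sum≡)
  where
  a≡c : a ≡ c
  a≡c = +-cancelˡ-≡ ((a + b) * (a + b)) a c (trans eq (cong (λ s → s * s + c) (sym sum≡)))

tag : ∀ {n} → PR n → ℕ
tag zeroF      = 0
tag succF      = 1
tag (proj _)   = 2
tag (comp _ _) = 3
tag (prec _ _) = 4
tag (mu _)     = 5

body : ∀ {n} → PR n → ℕ
body {n} zeroF           = n
body succF               = 0
body {n} (proj i)        = pair n (toℕ i)
body {n} (comp {m} g hs) = pair (pair m n) (pair (code g) (codeVec hs))
body {suc n} (prec g h)  = pair n (pair (code g) (code h))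
body {n} (mu f)          = pair n (code f)

code≡pair-tag-body : ∀ {n} (p : PR n) → code p ≡ pair (tag p) (body p)
code≡pair-tag-body zeroF      = refl
code≡pair-tag-body succF      = refl
code≡pair-tag-body (proj _)   = refl
code≡pair-tag-body (comp _ _) = refl
code≡pair-tag-body {suc n} (prec _ _) = refl
code≡pair-tag-body (mu _)     = refl

mutual
  code-injective : ∀ {n} {p q : PR n} → code p ≡ code q → p ≡ q
  code-injective {p = p} {q} eq =
    let tag≡ , body≡ = pair-injective (tag p) (body p) (tag q) (body q)
                         (trans (sym (code≡pair-tag-body p)) (trans eq (code≡pair-tag-body q)))
    in  same-tag-injective p q tag≡ body≡

  codeVec-injective : ∀ {m n} {hs hs' : Vec (PR n) m} → codeVec hs ≡ codeVec hs' → hs ≡ hs'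
  codeVec-injective {hs = []}    {[]}      _  = refl
  codeVec-injective {hs = h ∷ hs} {h' ∷ hs'} eq =
    let h≡ , hs≡ = pair-injective (code h) (codeVec hs) (code h') (codeVec hs') (suc-injective eq)
    in  cong₂ _∷_ (code-injective h≡) (codeVec-injective hs≡)

  same-tag-injective : ∀ {n} (p q : PR n) → tag p ≡ tag q → body p ≡ body q → p ≡ q
  same-tag-injective zeroF zeroF _ _ = refl
  same-tag-injective succF succF _ _ = refl
  same-tag-injective {n} (proj i) (proj j) _ eq =
    cong proj (toℕ-injective (proj₂ (pair-injective n (toℕ i) n (toℕ j) eq)))
  same-tag-injective {n} (comp {m} g hs) (comp {m'} g' hs') _ eq
    with arity≡ , args≡ ← pair-injective (pair m n) (pair (code g) (codeVec hs))
                                          (pair m' n) (pair (code g') (codeVec hs')) eq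
    with refl ← proj₁ (pair-injective m n m' n arity≡)
    = let g≡ , hs≡ = pair-injective (code g) (codeVec hs) (code g') (codeVec hs') args≡
      in  cong₂ comp (code-injective g≡) (codeVec-injective hs≡)
  same-tag-injective {suc n} (prec g h) (prec g' h') _ eq =
    let g≡ , h≡ = pair-injective (code g) (code h) (code g') (code h')
                    (proj₂ (pair-injective n (pair (code g) (code h)) n (pair (code g') (code h')) eq))
    in  cong₂ prec (code-injective g≡) (code-injective h≡)
  same-tag-injective {n} (mu f) (mu f') _ eq =
    cong mu (code-injective (proj₂ (pair-injective n (code f) n (code f') eq)))

mutual
  Eval-deterministic : ∀ {n} {f : PR n} {xs r r'} → Eval f xs r → Eval f xs r' → r ≡ r'
  Eval-deterministic ev-zero ev-zero = refl
  Eval-deterministic ev-succ ev-succ = refl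
  Eval-deterministic ev-proj ev-proj = refl
  Eval-deterministic (ev-comp as a) (ev-comp bs b)
    with refl ← EvalVec-deterministic as bs = Eval-deterministic a b
  Eval-deterministic (ev-prec-z a) (ev-prec-z b) = Eval-deterministic a b
  Eval-deterministic (ev-prec-s a a') (ev-prec-s b b')
    with refl ← Eval-deterministic a b = Eval-deterministic a' b'
  Eval-deterministic (ev-mu a) (ev-mu b) = MuFrom-deterministic a b

  EvalVec-deterministic : ∀ {m n} {hs : Vec (PR n) m} {xs ys ys'} →
                          EvalVec hs xs ys → EvalVec hs xs ys' → ys ≡ ys'
  EvalVec-deterministic evv-[] evv-[] = refl
  EvalVec-deterministic (evv-∷ a as) (evv-∷ b bs) =
    cong₂ _∷_ (Eval-deterministic a b) (EvalVec-deterministic as bs)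

  MuFrom-deterministic : ∀ {n} {f : PR (suc n)} {xs k r r'} →
                         MuFrom f xs k r → MuFrom f xs k r' → r ≡ r'
  MuFrom-deterministic (mu-here _) (mu-here _) = refl
  MuFrom-deterministic (mu-here a) (mu-next b _) with () ← Eval-deterministic a b
  MuFrom-deterministic (mu-next a _) (mu-here b) with () ← Eval-deterministic a b
  MuFrom-deterministic (mu-next _ a) (mu-next _ b) = MuFrom-deterministic a b

nonzero⇒¬MuFrom : ∀ {n} {f : PR (suc n)} {xs k r} m →
                 (∀ j → Eval f (j ∷ xs) (suc m)) → ¬ MuFrom f xs k r
nonzero⇒¬MuFrom m f≡suc (mu-here a) with () ← Eval-deterministic a (f≡suc _)
nonzero⇒¬MuFrom m f≡suc (mu-next _ rest) = nonzero⇒¬MuFrom m f≡suc rest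

-- Programs for total functions

Computes : ∀ {n} → PR n → (Vec ℕ n → ℕ) → Set
Computes p f = ∀ xs → Eval p xs (f xs)

ProgramFor : ∀ {n} → (Vec ℕ n → ℕ) → Set
ProgramFor {n} f = Σ (PR n) λ p → Computes p f

ProgramFor-resp-≗ : ∀ {n} {f g : Vec ℕ n → ℕ} → f ≗ g → ProgramFor f → ProgramFor g
ProgramFor-resp-≗ f≗g (p , p-computes) = p , λ xs → subst (Eval p xs) (f≗g xs) (p-computes xs)

unary : (ℕ → ℕ) → Vec ℕ 1 → ℕ
unary f (a ∷ []) = f a

binary : (ℕ → ℕ → ℕ) → Vec ℕ 2 → ℕ
binary f (a ∷ b ∷ []) = f a b

ternary : (ℕ → ℕ → ℕ → ℕ) → Vec ℕ 3 → ℕ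
ternary f (a ∷ b ∷ c ∷ []) = f a b c

konst : ∀ {n} → ℕ → PR n
konst zero    = zeroF
konst (suc c) = comp succF [ konst c ]

konst-computes : ∀ {n} c → Computes (konst {n} c) (λ _ → c)
konst-computes zero    xs = ev-zero
konst-computes (suc c) xs = ev-comp (evv-∷ (konst-computes c xs) evv-[]) ev-succ

konstProgram : ∀ {n} c → ProgramFor {n} (λ _ → c)
konstProgram c = konst c , konst-computes c

primRec : ∀ {n} → (Vec ℕ n → ℕ) → (Vec ℕ (2 + n) → ℕ) → Vec ℕ (suc n) → ℕ
primRec g h (zero  ∷ xs) = g xs
primRec g h (suc k ∷ xs) = h (k ∷ primRec g h (k ∷ xs) ∷ xs)

precProgram : ∀ {n} {g : Vec ℕ n → ℕ} {h} → ProgramFor g → ProgramFor h → ProgramFor (primRec g h)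
precProgram {g = g} {h} (G , G-computes) (H , H-computes) = prec G H , λ { (k ∷ xs) → prec-computes k xs }
  where
  prec-computes : ∀ k xs → Eval (prec G H) (k ∷ xs) (primRec g h (k ∷ xs))
  prec-computes zero    xs = ev-prec-z (G-computes xs)
  prec-computes (suc k) xs = ev-prec-s (prec-computes k xs) (H-computes _)

succProgram : ProgramFor (unary suc)
succProgram = succF , λ { (x ∷ []) → ev-succ }

addProgram : ProgramFor (binary _+_)
addProgram = add , λ { (k ∷ y ∷ []) → add-computes k y }
  where
  add : PR 2
  add = prec (proj fzero) (comp succF [ proj (fsuc fzero) ])
  add-computes : ∀ k y → Eval add (k ∷ y ∷ []) (k + y)
  add-computes zero    y = ev-prec-z ev-proj
  add-computes (suc k) y = ev-prec-s (add-computes k y) (ev-comp (evv-∷ ev-proj evv-[]) ev-succ)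

mulProgram : ProgramFor (binary _*_)
mulProgram = mul , λ { (k ∷ y ∷ []) → mul-computes k y }
  where
  mul : PR 2
  mul = prec zeroF (comp (proj₁ addProgram) (proj (fsuc (fsuc fzero)) ∷ proj (fsuc fzero) ∷ []))
  mul-computes : ∀ k y → Eval mul (k ∷ y ∷ []) (k * y)
  mul-computes zero    y = ev-prec-z ev-zero
  mul-computes (suc k) y = ev-prec-s (mul-computes k y)
    (ev-comp (evv-∷ ev-proj (evv-∷ ev-proj evv-[])) (proj₂ addProgram (y ∷ k * y ∷ [])))

predProgram : ProgramFor (unary pred)
predProgram = prec zeroF (proj fzero) , λ { (k ∷ []) → pred-computes k }
  where
  pred-computes : ∀ k → Eval (prec zeroF (proj fzero)) [ k ] (pred k)
  pred-computes zero    = ev-prec-z ev-zero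
  pred-computes (suc k) = ev-prec-s (pred-computes k) ev-proj

ifZero : ℕ → ℕ → ℕ → ℕ
ifZero zero    a b = a
ifZero (suc _) a b = b

ifZeroProgram : ProgramFor (ternary ifZero)
ifZeroProgram = ifz , λ { (z ∷ a ∷ b ∷ []) → ifZero-computes z a b }
  where
  ifz : PR 3
  ifz = prec (proj fzero) (proj (fsuc (fsuc (fsuc fzero))))
  ifZero-computes : ∀ z a b → Eval ifz (z ∷ a ∷ b ∷ []) (ifZero z a b)
  ifZero-computes zero    a b = ev-prec-z ev-proj
  ifZero-computes (suc z) a b = ev-prec-s (ifZero-computes z a b) ev-proj

data Expr (n : ℕ) : Set where
  var  : Fin n → Expr n
  lit  : ℕ → Expr n
  call : ∀ {m} {f : Vec ℕ m → ℕ} → ProgramFor f → Vec (Expr n) m → Expr n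

mutual
  ⟦_⟧ : ∀ {n} → Expr n → Vec ℕ n → ℕ
  ⟦ var i ⟧            xs = lookup xs i
  ⟦ lit c ⟧            xs = c
  ⟦ call {f = f} _ es ⟧ xs = f (⟦ es ⟧* xs)

  ⟦_⟧* : ∀ {m n} → Vec (Expr n) m → Vec ℕ n → Vec ℕ m
  ⟦ [] ⟧*     xs = []
  ⟦ e ∷ es ⟧* xs = ⟦ e ⟧ xs ∷ ⟦ es ⟧* xs

mutual
  compile : ∀ {n} → Expr n → PR n
  compile (var i)    = proj i
  compile (lit c)    = konst c
  compile (call P es) = comp (proj₁ P) (compile* es)

  compile* : ∀ {m n} → Vec (Expr n) m → Vec (PR n) m
  compile* []       = []
  compile* (e ∷ es) = compile e ∷ compile* es

mutual
  compile-computes : ∀ {n} (e : Expr n) → Computes (compile e) ⟦ e ⟧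
  compile-computes (var i)     xs = ev-proj
  compile-computes (lit c)     xs = konst-computes c xs
  compile-computes (call P es) xs = ev-comp (compile*-computes es xs) (proj₂ P _)

  compile*-computes : ∀ {m n} (es : Vec (Expr n) m) xs → EvalVec (compile* es) xs (⟦ es ⟧* xs)
  compile*-computes []       xs = evv-[]
  compile*-computes (e ∷ es) xs = evv-∷ (compile-computes e xs) (compile*-computes es xs)

programOf : ∀ {n} {f : Vec ℕ n → ℕ} (e : Expr n) → ⟦ e ⟧ ≗ f → ProgramFor f
programOf e e≗f = ProgramFor-resp-≗ e≗f (compile e , compile-computes e)

vars : ∀ {k n} → (Fin n → Fin k) → Vec (Expr k) n
vars {n = zero}  ρ = []
vars {n = suc n} ρ = var (ρ fzero) ∷ vars (ρ ∘ fsuc)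

⟦vars⟧ : ∀ {k n} (ρ : Fin n → Fin k) env xs →
         (∀ i → lookup env (ρ i) ≡ lookup xs i) → ⟦ vars ρ ⟧* env ≡ xs
⟦vars⟧ ρ env []       _    = refl
⟦vars⟧ ρ env (x ∷ xs) ρ≗xs = cong₂ _∷_ (ρ≗xs fzero) (⟦vars⟧ (ρ ∘ fsuc) env xs (ρ≗xs ∘ fsuc))

trailing : ∀ k {n} → Vec (Expr (k + n)) n
trailing k = vars (k ↑ʳ_)

⟦trailing⟧ : ∀ {k n} (ys : Vec ℕ k) (xs : Vec ℕ n) → ⟦ trailing k ⟧* (ys ++ xs) ≡ xs
⟦trailing⟧ ys xs = ⟦vars⟧ _ (ys ++ xs) xs (lookup-++ʳ ys xs)

infixl 6 _⊕_
infixl 7 _⊗_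

_⊕_ _⊗_ : ∀ {n} → Expr n → Expr n → Expr n
a ⊕ b = call addProgram (a ∷ b ∷ [])
a ⊗ b = call mulProgram (a ∷ b ∷ [])

sucE predE : ∀ {n} → Expr n → Expr n
sucE  a = call succProgram [ a ]
predE a = call predProgram [ a ]

ifZeroE : ∀ {n} → Expr n → Expr n → Expr n → Expr n
ifZeroE z a b = call ifZeroProgram (z ∷ a ∷ b ∷ [])

pairE : ∀ {n} → Expr n → Expr n → Expr n
pairE a b = (a ⊕ b) ⊗ (a ⊕ b) ⊕ a

tripleE : ∀ {n} → Expr n → Expr n → Expr n → Expr n
tripleE a b c = pairE (pairE a b) c

-- Clocked evaluation

allDefined : ∀ {m} → Vec ℕ m → ℕ
allDefined []       = 1
allDefined (y ∷ ys) = ifZero y 0 (allDefined ys)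

-- States of the bounded μ-search searchState: 0 while searching, 1 once stuck on a value not
-- computed in time, 2 + c once the zero c is found.
verdict : ℕ → ℕ → ℕ
verdict v c = ifZero v 1 (ifZero (pred v) (suc (suc c)) 0)

-- Results are encoded in ℕ: 0 means no result within the time bound, suc r means the result r.
mutual
  clocked : ∀ {n} → ℕ → PR n → Vec ℕ n → ℕ
  clocked t zeroF       xs       = 1
  clocked t succF       (x ∷ []) = suc (suc x)
  clocked t (proj i)    xs       = suc (lookup xs i)
  clocked t (comp g hs) xs       =
    ifZero (allDefined (clocked* t hs xs)) 0 (clocked t g (map pred (clocked* t hs xs)))
  clocked t (prec g h)  (k ∷ xs) = primRec (clockedOn g) (recursionStep h) (k ∷ t ∷ xs)
  clocked t (mu f)      xs       = pred (searchState f (t ∷ t ∷ xs))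

  clocked* : ∀ {m n} → ℕ → Vec (PR n) m → Vec ℕ n → Vec ℕ m
  clocked* t []       xs = []
  clocked* t (h ∷ hs) xs = clocked t h xs ∷ clocked* t hs xs

  clockedOn : ∀ {n} → PR n → Vec ℕ (suc n) → ℕ
  clockedOn f (t ∷ xs) = clocked t f xs

  recursionStep : ∀ {n} → PR (2 + n) → Vec ℕ (3 + n) → ℕ
  recursionStep h (k ∷ r ∷ t ∷ xs) = ifZero r 0 (clocked t h (k ∷ pred r ∷ xs))

  searchState : ∀ {n} → PR (suc n) → Vec ℕ (2 + n) → ℕ
  searchState f = primRec (λ _ → 0) (searchStep f)

  searchStep : ∀ {n} → PR (suc n) → Vec ℕ (3 + n) → ℕ
  searchStep f (c ∷ s ∷ t ∷ xs) = ifZero s (verdict (clocked t f (c ∷ xs)) c) s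

mutual
  clocked-sound : ∀ {n} (f : PR n) t xs {r} → clocked t f xs ≡ suc r → Eval f xs r
  clocked-sound zeroF    t xs       refl = ev-zero
  clocked-sound succF    t (x ∷ []) refl = ev-succ
  clocked-sound (proj i) t xs       refl = ev-proj
  clocked-sound (comp g hs) t xs eq with allDefined (clocked* t hs xs) in defined
  ... | suc _ = ev-comp (clocked*-sound hs t xs defined) (clocked-sound g t _ eq)
  clocked-sound (prec g h) t (k ∷ xs) eq = recursion-sound g h t k xs eq
  clocked-sound (mu f) t xs eq with searchState f (t ∷ t ∷ xs) in found
  ... | suc (suc j) with refl ← eq = ev-mu (search-found f t xs t found)

  clocked*-sound : ∀ {m n} (hs : Vec (PR n) m) t xs {d} → allDefined (clocked* t hs xs) ≡ suc d →
                   EvalVec hs xs (map pred (clocked* t hs xs))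
  clocked*-sound []       t xs _ = evv-[]
  clocked*-sound (h ∷ hs) t xs defined with clocked t h xs in eq
  ... | suc _ = evv-∷ (clocked-sound h t xs eq) (clocked*-sound hs t xs defined)

  recursion-sound : ∀ {n} (g : PR n) h t k xs {r} →
                    primRec (clockedOn g) (recursionStep h) (k ∷ t ∷ xs) ≡ suc r → Eval (prec g h) (k ∷ xs) r
  recursion-sound g h t zero    xs eq = ev-prec-z (clocked-sound g t xs eq)
  recursion-sound g h t (suc k) xs eq with primRec (clockedOn g) (recursionStep h) (k ∷ t ∷ xs) in eq′
  ... | suc _ = ev-prec-s (recursion-sound g h t k xs eq′) (clocked-sound h t _ eq)

  -- a search still running at c has met only defined nonzero values below c
  search-running : ∀ {n} (f : PR (suc n)) t xs c → searchState f (c ∷ t ∷ xs) ≡ 0 →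
                   ∀ {r} → MuFrom f xs c r → MuFrom f xs 0 r
  search-running f t xs zero    _       m = m
  search-running f t xs (suc c) running m with searchState f (c ∷ t ∷ xs) in running′
  ... | zero with clocked t f (c ∷ xs) in eq
  ...   | suc (suc _) = search-running f t xs c running′ (mu-next (clocked-sound f t (c ∷ xs) eq) m)

  search-found : ∀ {n} (f : PR (suc n)) t xs c {j} → searchState f (c ∷ t ∷ xs) ≡ suc (suc j) →
                 MuFrom f xs 0 j
  search-found f t xs (suc c) found with searchState f (c ∷ t ∷ xs) in found′
  ... | suc _ = search-found f t xs c (trans found′ found)
  ... | zero with clocked t f (c ∷ xs) in eq
  ...   | suc zero with refl ← found =
    search-running f t xs c found′ (mu-here (clocked-sound f t (c ∷ xs) eq))

Eventually : (ℕ → Set) → Set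
Eventually P = ∃ λ t₀ → ∀ t → t₀ ≤ t → P t

Eventually-× : ∀ {P Q : ℕ → Set} → Eventually P → Eventually Q → Eventually (λ t → P t × Q t)
Eventually-× (a , P) (b , Q) = a ⊔ b , λ t a⊔b≤t →
  P t (≤-trans (m≤m⊔n a b) a⊔b≤t) , Q t (≤-trans (m≤n⊔m a b) a⊔b≤t)

allDefined-suc : ∀ {m} (ys : Vec ℕ m) → allDefined (map suc ys) ≡ 1
allDefined-suc []       = refl
allDefined-suc (y ∷ ys) = allDefined-suc ys

map-pred-suc : ∀ {m} (ys : Vec ℕ m) → map pred (map suc ys) ≡ ys
map-pred-suc []       = refl
map-pred-suc (y ∷ ys) = cong (y ∷_) (map-pred-suc ys)

searchState-stable : ∀ {n} (f : PR (suc n)) t xs c {s} → searchState f (c ∷ t ∷ xs) ≡ suc s →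
                     ∀ c′ → c ≤ c′ → searchState f (c′ ∷ t ∷ xs) ≡ suc s
searchState-stable f t xs c eq c′ c≤c′ = stable c′ (≤⇒≤′ c≤c′)
  where
  stable : ∀ c′ → c ≤′ c′ → searchState f (c′ ∷ t ∷ xs) ≡ suc _
  stable c′       ≤′-refl        = eq
  stable (suc c′) (≤′-step c≤c′) rewrite stable c′ c≤c′ = refl

mutual
  clocked-complete : ∀ {n} {f : PR n} {xs r} → Eval f xs r → Eventually (λ t → clocked t f xs ≡ suc r)
  clocked-complete ev-zero = 0 , λ _ _ → refl
  clocked-complete ev-succ = 0 , λ _ _ → refl
  clocked-complete ev-proj = 0 , λ _ _ → refl
  clocked-complete {f = comp g hs} {xs} {r} (ev-comp {ys = ys} args res)
    with t₀ , both ← Eventually-× (clocked*-complete args) (clocked-complete res) =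
    t₀ , λ t t₀≤t → comp-value t (both t t₀≤t)
    where
    comp-value : ∀ t → (clocked* t hs xs ≡ map suc ys) × (clocked t g ys ≡ suc r) →
                 clocked t (comp g hs) xs ≡ suc r
    comp-value t (args≡ , res≡) rewrite args≡ | allDefined-suc ys | map-pred-suc ys = res≡
  clocked-complete (ev-prec-z base) = clocked-complete base
  clocked-complete {f = prec g h} {suc k ∷ xs} {r} (ev-prec-s {r' = r'} rest step)
    with t₀ , both ← Eventually-× (clocked-complete rest) (clocked-complete step) =
    t₀ , λ t t₀≤t → step-value t (both t t₀≤t)
    where
    step-value : ∀ t → (clocked t (prec g h) (k ∷ xs) ≡ suc r') × (clocked t h (k ∷ r' ∷ xs) ≡ suc r) →
                 clocked t (prec g h) (suc k ∷ xs) ≡ suc r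
    step-value t (rest≡ , step≡) rewrite rest≡ = step≡
  clocked-complete {f = mu f} {xs} {r} (ev-mu search)
    with t₀ , found ← search-complete search =
    t₀ ⊔ suc r , λ t bound → cong pred
      (searchState-stable f t xs (suc r) (found t (≤-trans (m≤m⊔n t₀ (suc r)) bound) refl)
                          t (≤-trans (m≤n⊔m t₀ (suc r)) bound))

  clocked*-complete : ∀ {m n} {hs : Vec (PR n) m} {xs ys} → EvalVec hs xs ys →
                      Eventually (λ t → clocked* t hs xs ≡ map suc ys)
  clocked*-complete evv-[] = 0 , λ _ _ → refl
  clocked*-complete (evv-∷ a as) with t₀ , both ← Eventually-× (clocked-complete a) (clocked*-complete as) =
    t₀ , λ t t₀≤t → cong₂ _∷_ (proj₁ (both t t₀≤t)) (proj₂ (both t t₀≤t))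

  search-complete : ∀ {n} {f : PR (suc n)} {xs c r} → MuFrom f xs c r →
                    Eventually (λ t → searchState f (c ∷ t ∷ xs) ≡ 0 →
                                      searchState f (suc r ∷ t ∷ xs) ≡ suc (suc r))
  search-complete {f = f} {xs} {c} (mu-here zero-at-c) with t₀ , P ← clocked-complete zero-at-c =
    t₀ , λ t t₀≤t running → found t (P t t₀≤t) running
    where
    found : ∀ t → clocked t f (c ∷ xs) ≡ 1 → searchState f (c ∷ t ∷ xs) ≡ 0 →
            searchState f (suc c ∷ t ∷ xs) ≡ suc (suc c)
    found t one running rewrite running | one = refl
  search-complete {f = f} {xs} {c} (mu-next {m = m} nonzero-at-c rest)
    with t₀ , both ← Eventually-× (clocked-complete nonzero-at-c) (search-complete rest) =
    t₀ , λ t t₀≤t running → proj₂ (both t t₀≤t) (continue t (proj₁ (both t t₀≤t)) running)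
    where
    continue : ∀ t → clocked t f (c ∷ xs) ≡ suc (suc m) → searchState f (c ∷ t ∷ xs) ≡ 0 →
               searchState f (suc c ∷ t ∷ xs) ≡ 0
    continue t nonzero running rewrite running | nonzero = refl

allDefinedE : ∀ {m n} → Vec (Expr n) m → Expr n
allDefinedE []       = lit 1
allDefinedE (e ∷ es) = ifZeroE e (lit 0) (allDefinedE es)

⟦allDefinedE⟧ : ∀ {m n} (es : Vec (Expr n) m) env → ⟦ allDefinedE es ⟧ env ≡ allDefined (⟦ es ⟧* env)
⟦allDefinedE⟧ []       env = refl
⟦allDefinedE⟧ (e ∷ es) env = cong (ifZero (⟦ e ⟧ env) 0) (⟦allDefinedE⟧ es env)

predE* : ∀ {m n} → Vec (Expr n) m → Vec (Expr n) m
predE* []       = []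
predE* (e ∷ es) = predE e ∷ predE* es

⟦predE*⟧ : ∀ {m n} (es : Vec (Expr n) m) env → ⟦ predE* es ⟧* env ≡ map pred (⟦ es ⟧* env)
⟦predE*⟧ []       env = refl
⟦predE*⟧ (e ∷ es) env = cong (pred (⟦ e ⟧ env) ∷_) (⟦predE*⟧ es env)

verdictE : ∀ {n} → Expr n → Expr n → Expr n
verdictE v c = ifZeroE v (lit 1) (ifZeroE (predE v) (sucE (sucE c)) (lit 0))

mutual
  clockedCalls : ∀ {m n} → Vec (PR n) m → Vec (Expr (suc n)) m
  clockedCalls []       = []
  clockedCalls (h ∷ hs) = call (clockedProgram h) (trailing 0) ∷ clockedCalls hs

  ⟦clockedCalls⟧ : ∀ {m n} (hs : Vec (PR n) m) t xs → ⟦ clockedCalls hs ⟧* (t ∷ xs) ≡ clocked* t hs xs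
  ⟦clockedCalls⟧ []       t xs = refl
  ⟦clockedCalls⟧ (h ∷ hs) t xs =
    cong₂ _∷_ (cong (clockedOn h) (⟦trailing⟧ [] (t ∷ xs))) (⟦clockedCalls⟧ hs t xs)

  clockedProgram : ∀ {n} (f : PR n) → ProgramFor (clockedOn f)
  clockedProgram zeroF    = programOf (lit 1) λ { (t ∷ xs) → refl }
  clockedProgram succF    = programOf (sucE (sucE (var (fsuc fzero)))) λ { (t ∷ x ∷ []) → refl }
  clockedProgram (proj i) = programOf (sucE (var (fsuc i))) λ { (t ∷ xs) → refl }
  clockedProgram {n} (comp {m} g hs) =
    programOf (ifZeroE (allDefinedE calls) (lit 0) (call (clockedProgram g) (var fzero ∷ predE* calls)))
      λ { (t ∷ xs) → comp-value t xs }
    where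
    calls : Vec (Expr (suc n)) m
    calls = clockedCalls hs
    comp-value : ∀ t xs →
      ifZero (⟦ allDefinedE calls ⟧ (t ∷ xs)) 0 (clocked t g (⟦ predE* calls ⟧* (t ∷ xs)))
        ≡ clocked t (comp g hs) xs
    comp-value t xs
      rewrite ⟦allDefinedE⟧ calls (t ∷ xs) | ⟦predE*⟧ calls (t ∷ xs) | ⟦clockedCalls⟧ hs t xs = refl
  clockedProgram (prec g h) =
    programOf (call (precProgram (clockedProgram g) (recursionStepProgram h))
                    (var (fsuc fzero) ∷ var fzero ∷ trailing 2))
      λ { (t ∷ k ∷ xs) → cong (λ ys → primRec (clockedOn g) (recursionStep h) (k ∷ t ∷ ys))
                              (⟦trailing⟧ (t ∷ k ∷ []) xs) }
  clockedProgram (mu f) =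
    programOf (predE (call (precProgram (konstProgram 0) (searchStepProgram f))
                           (var fzero ∷ var fzero ∷ trailing 1)))
      λ { (t ∷ xs) → cong (λ ys → pred (searchState f (t ∷ t ∷ ys))) (⟦trailing⟧ [ t ] xs) }

  recursionStepProgram : ∀ {n} (h : PR (2 + n)) → ProgramFor (recursionStep h)
  recursionStepProgram {n} h =
    programOf (ifZeroE (var r) (lit 0)
                 (call (clockedProgram h) (var t ∷ var k ∷ predE (var r) ∷ trailing 3)))
      λ { (k ∷ r ∷ t ∷ xs) → cong (λ ys → ifZero r 0 (clocked t h (k ∷ pred r ∷ ys)))
                                  (⟦trailing⟧ (k ∷ r ∷ t ∷ []) xs) }
    where
    k r t : Fin (3 + n)
    k = fzero
    r = fsuc fzero
    t = fsuc (fsuc fzero)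

  searchStepProgram : ∀ {n} (f : PR (suc n)) → ProgramFor (searchStep f)
  searchStepProgram {n} f =
    programOf (ifZeroE (var s) (verdictE (call (clockedProgram f) (var t ∷ var c ∷ trailing 3)) (var c)) (var s))
      λ { (c ∷ s ∷ t ∷ xs) → cong (λ ys → ifZero s (verdict (clocked t f (c ∷ ys)) c) s)
                                  (⟦trailing⟧ (c ∷ s ∷ t ∷ []) xs) }
    where
    c s t : Fin (3 + n)
    c = fzero
    s = fsuc fzero
    t = fsuc (fsuc fzero)

-- Kleene's recursion theorem

konstCodeProgram : ProgramFor (unary (code ∘ konst {1}))
konstCodeProgram = konstCode , λ { (b ∷ []) → konstCode-computes b }
  where
  -- code (konst (suc b)) in terms of c = code (konst b)
  nextCode : Expr 2
  nextCode = pairE (lit 3) (pairE (lit (pair 1 1))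
               (pairE (lit (code succF)) (sucE (pairE (var (fsuc fzero)) (lit 0)))))
  konstCode : PR 1
  konstCode = prec (konst (code (konst {1} 0))) (compile nextCode)
  konstCode-computes : ∀ b → Eval konstCode [ b ] (code (konst {1} b))
  konstCode-computes zero    = ev-prec-z (konst-computes _ [])
  konstCode-computes (suc b) =
    ev-prec-s (konstCode-computes b) (compile-computes nextCode (b ∷ code (konst {1} b) ∷ []))

fixFirst : PR 2 → ℕ → PR 1
fixFirst B b = comp B (konst b ∷ proj fzero ∷ [])

Eval-fixFirst : ∀ {B b t r} → Eval (fixFirst B b) [ t ] r ⇔ Eval B (b ∷ t ∷ []) r
Eval-fixFirst {b = b} {t} = mk⇔
  (λ { (ev-comp (evv-∷ konst-b (evv-∷ ev-proj evv-[])) B-eval)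
         → subst (λ b′ → Eval _ (b′ ∷ t ∷ []) _) (Eval-deterministic konst-b (konst-computes b _)) B-eval })
  (ev-comp (evv-∷ (konst-computes b _) (evv-∷ ev-proj evv-[])))

selfFixFirstCode : ℕ → ℕ
selfFixFirstCode u = pair 3 (pair (pair 2 1)
  (pair u (suc (pair (code (konst {1} u)) (suc (pair (code (proj {1} fzero)) 0))))))

selfFixFirstCodeProgram : ProgramFor (unary selfFixFirstCode)
selfFixFirstCodeProgram =
  programOf (pairE (lit 3) (pairE (lit (pair 2 1))
              (pairE u (sucE (pairE (call konstCodeProgram [ u ])
                                    (sucE (pairE (lit (code (proj {1} fzero))) (lit 0))))))))
    λ { (_ ∷ []) → refl }
  where
  u : Expr 1
  u = var fzero

-- By refl for a variable B only: for a concrete B the conversion would unfold the numeral code B.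
code-fixFirst-self : ∀ B → code (fixFirst B (code B)) ≡ selfFixFirstCode (code B)
code-fixFirst-self B = refl

-- Opaque so that the fixed point, whose code is an astronomically large numeral, never unfolds.
opaque
  recursion-theorem : (G : PR 2) → Σ (PR 1) λ T → ∀ {t r} → Eval T [ t ] r ⇔ Eval G (code T ∷ t ∷ []) r
  recursion-theorem G = fixFirst B (code B) ,
      subst (λ c → ∀ {t r} → Eval (fixFirst B (code B)) [ t ] r ⇔ Eval G (c ∷ t ∷ []) r)
            (sym (code-fixFirst-self B)) (Eval-B ⇔-∘ Eval-fixFirst)
    where
    open Σ selfFixFirstCodeProgram renaming (proj₁ to D; proj₂ to D-computes)
    B : PR 2
    B = comp G (comp D [ proj fzero ] ∷ proj (fsuc fzero) ∷ [])
    Eval-B : ∀ {b t r} → Eval B (b ∷ t ∷ []) r ⇔ Eval G (selfFixFirstCode b ∷ t ∷ []) r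
    Eval-B {b} {t} = mk⇔
      (λ { (ev-comp (evv-∷ (ev-comp (evv-∷ ev-proj evv-[]) D-eval) (evv-∷ ev-proj evv-[])) G-eval)
             → subst (λ c → Eval G (c ∷ t ∷ []) _) (Eval-deterministic D-eval (D-computes [ b ])) G-eval })
      (ev-comp (evv-∷ (ev-comp (evv-∷ ev-proj evv-[]) (D-computes [ b ])) (evv-∷ ev-proj evv-[])))

-- The diagonal argument

Halts : ℕ → ℕ → Set
Halts e v = ∃ (Φ e v)

Φ⇒Eval : ∀ {p e v r} → code p ≡ e → Φ e v r → Eval p [ v ] r
Φ⇒Eval {p} p≡e (q , q≡e , q-eval) with refl ← code-injective {p = q} {p} (trans q≡e (sym p≡e)) = q-eval

IsIndexOf⇒¬¬Halts : ∀ {e A} → IsIndexOf e A → ∀ v → ¬ ¬ Halts e v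
IsIndexOf⇒¬¬Halts index v ¬halts =
  ¬halts (0 , proj₂ (index v) λ Av → ¬halts (1 , proj₁ (index v) Av))

emptyIndex fullIndex : ℕ
emptyIndex = code (zeroF {1})
fullIndex  = code (konst {1} 1)

Φ-emptyIndex : ∀ v → Φ emptyIndex v 0
Φ-emptyIndex v = zeroF , refl , ev-zero

Φ-fullIndex : ∀ v → Φ fullIndex v 1
Φ-fullIndex v = konst 1 , refl , konst-computes 1 [ v ]

module _ (p : PR 1) where

  -- lit fullIndex would compile to fullIndex nested successors, so the constant is computed instead
  probe : Expr 3
  probe = call (clockedProgram p)
    (var (fsuc (fsuc fzero)) ∷ tripleE (var (fsuc fzero)) (lit emptyIndex) (call konstCodeProgram [ lit 1 ]) ∷ [])

  ⟦probe⟧ : ∀ j c t → ⟦ probe ⟧ (j ∷ c ∷ t ∷ []) ≡ clocked t p [ triple c emptyIndex fullIndex ]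
  ⟦probe⟧ j c t = refl

  zeroWhileRunning : PR 2
  zeroWhileRunning = mu (compile probe)

  probe-computes : ∀ j c t → Eval (compile probe) (j ∷ c ∷ t ∷ []) (clocked t p [ triple c emptyIndex fullIndex ])
  probe-computes j c t = subst (Eval _ _) (⟦probe⟧ j c t) (compile-computes probe (j ∷ c ∷ t ∷ []))

  zeroWhileRunning-halted : ∀ c {t m r} → clocked t p [ triple c emptyIndex fullIndex ] ≡ suc m →
                            ¬ Eval zeroWhileRunning (c ∷ t ∷ []) r
  zeroWhileRunning-halted c {t} halted (ev-mu search) =
    nonzero⇒¬MuFrom _ (λ j → subst (Eval _ _) halted (probe-computes j c t)) search

  zeroWhileRunning-running : ∀ c {t} → clocked t p [ triple c emptyIndex fullIndex ] ≡ 0 →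
                             Eval zeroWhileRunning (c ∷ t ∷ []) 0
  zeroWhileRunning-running c {t} running =
    ev-mu (mu-here (subst (Eval _ _) running (probe-computes 0 c t)))

module _ {ℓ} (B : ℕ → Set ℓ)
         (∅-index∈B : ∀ {a} → (∀ v → Φ a v 0) → B (triple a emptyIndex fullIndex))
         (∈B⇒total : ∀ {a b c} → B (triple a b c) → ∀ v → ¬ ¬ Halts a v) where

  not-halting-set : (p : PR 1) → ¬ (∀ w → B w ⇔ ∃ (Eval p [ w ]))
  not-halting-set p B⇔halts with recursion-theorem (zeroWhileRunning p)
  ... | T , T-spec = p-diverges (proj₂ (Equivalence.to (B⇔halts w) (∅-index∈B T-index-of-∅)))
    where
    w : ℕ
    w = triple (code T) emptyIndex fullIndex
    p-diverges : ∀ {r} → ¬ Eval p [ w ] r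
    p-diverges halts with t₀ , halted ← clocked-complete halts =
      ∈B⇒total (Equivalence.from (B⇔halts w) (_ , halts)) t₀ λ (_ , φ) →
        zeroWhileRunning-halted p (code T) (halted t₀ ≤-refl) (Equivalence.to T-spec (Φ⇒Eval refl φ))
    T-index-of-∅ : ∀ t → Φ (code T) t 0
    T-index-of-∅ t with clocked t p [ w ] in running
    ... | zero  = T , refl , Equivalence.from T-spec (zeroWhileRunning-running p (code T) running)
    ... | suc _ = ⊥-elim (p-diverges (clocked-sound p t [ w ] running))

  ¬RecEnum : ¬ RecEnum B
  ¬RecEnum (e , B≡dom) with _ , p , p≡e , _ ← proj₁ (B≡dom _) (∅-index∈B Φ-emptyIndex) =
    not-halting-set p λ w → mk⇔
      (λ w∈B → let r , φ = proj₁ (B≡dom w) w∈B in r , Φ⇒Eval p≡e φ)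
      (λ (r , halts) → proj₂ (B≡dom w) (r , p , p≡e , halts))

triple-injective₁ : ∀ a b c a′ b′ c′ → triple a b c ≡ triple a′ b′ c′ → a ≡ a′
triple-injective₁ a b c a′ b′ c′ eq =
  proj₁ (pair-injective a b a′ b′ (proj₁ (pair-injective (pair a b) c (pair a′ b′) c′ eq)))

IsIndexOf-∅ : ∀ {a} → (∀ v → Φ a v 0) → IsIndexOf a (λ _ → ⊥)
IsIndexOf-∅ a-zero v = (λ ()) , (λ _ → a-zero v)

module _ (X : Set) (x y : X) where

  emptyProfile-code∈S : ∀ {a} → (∀ v → Φ a v 0) → S X x y (triple a emptyIndex fullIndex)
  emptyProfile-code∈S a-zero =
    (λ _ _ _ → ⊥) , (λ _ → (λ _ _ ()) , (λ _ _ _ _ _ ())) , (λ _ _ → emptyIndex , IsIndexOf-∅ Φ-emptyIndex) ,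
    (_ , _ , _ , refl , IsIndexOf-∅ a-zero , IsIndexOf-∅ Φ-emptyIndex ,
     λ v → (λ _ → Φ-fullIndex v) , (λ ¬¬⊥ → ⊥-elim (¬¬⊥ λ { (inj₁ ()) ; (inj₂ ()) })))

  S-first-total : ∀ {a b c} → S X x y (triple a b c) → ∀ v → ¬ ¬ Halts a v
  S-first-total {a} {b} {c} (_ , _ , _ , e₁ , e₂ , e₃ , eq , index₁ , _) =
    subst (λ e → ∀ v → ¬ ¬ Halts e v) (sym (triple-injective₁ a b c e₁ e₂ e₃ eq)) (IsIndexOf⇒¬¬Halts index₁)

mainTheorem7 : (X : Set) (x y : X) → x ≢ y → ¬ RecEnum (S X x y)
mainTheorem7 X x y _ = ¬RecEnum (S X x y) (emptyProfile-code∈S X x y) (S-first-total X x y)
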